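{- Let $r\geq 2$ and let $n_1,\dots,n_{r-1}$ be integers with $0\leq n_1\leq n_2\leq\cdots\leq n_{r-1}$. Then \[ \sum_{m_1,\dots,m_{r-1}\geq 0}\, \prod_{i=1}^{r-1} \frac{z_i^{m_i-m_{i+1}} q^{m_i^2-m_im_{i+1}}}{(z_iq)_{m_1-m_{i+1}}}\, {n_i-m_1+m_i \brack m_i-m_{i+1}} =\prod_{i=1}^{r-1} \frac{1}{(z_iq)_{n_i}}, \] where $m_r:=0$.
   Context: For $n\in\mathbb{Z}$, $(x)_n=(x;q)_n:=(x;q)_\infty/(xq^n;q)_\infty$ with $(x;q)_\infty=\prod_{i\ge0}(1-xq^i)$ (so $(x)_n=\prod_{i=0}^{n-1}(1-xq^i)$ for $n\geq0$). For $n,m\in\mathbb{Z}$, ${n\brack m}=\frac{(q)_n}{(q)_m(q)_{n-m}}$ if $0\leq m\leq n$ and $0$ otherwise, with $(q)_n=(q;q)_n$. The identity is one of rational functions in $z_1,\dots,z_{r-1},q$. -}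

module Defs where

open import Level using (Level; _⊔_)
open import Algebra.Bundles using (CommutativeRing)
open import Data.Nat as ℕ using (ℕ; zero; suc)
open import Data.Integer as ℤ using (ℤ; +_; -[1+_])
open import Data.Fin using (Fin; zero; suc; toℕ)
open import Relation.Nullary using (¬_; yes; no)

record Field (c ℓ : Level) : Set (Level.suc (c ⊔ ℓ)) where
  field
    commutativeRing : CommutativeRing c ℓ
  open CommutativeRing commutativeRing public
  field
    _⁻¹     : Carrier → Carrier
    0≉1     : ¬ (0# ≈ 1#)
    ⁻¹-inverse : ∀ x → ¬ (x ≈ 0#) → (x * (x ⁻¹)) ≈ 1#

module Over {c ℓ : Level} (F : Field c ℓ) where
  open Field F using (Carrier; _≈_; _+_; _*_; -_; 0#; 1#; _⁻¹)

  pow : Carrier → ℕ → Carrier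
  pow x zero    = 1#
  pow x (suc k) = x * pow x k

  powℤ : Carrier → ℤ → Carrier
  powℤ x (+ k)      = pow x k
  powℤ x -[1+ k ]   = pow (x ⁻¹) (suc k)

  prodFin : (k : ℕ) → (Fin k → Carrier) → Carrier
  prodFin zero    f = 1#
  prodFin (suc k) f = f zero * prodFin k (λ i → f (suc i))

  sumTo : ℕ → (ℕ → Carrier) → Carrier
  sumTo zero    f = f zero
  sumTo (suc B) f = sumTo B f + f (suc B)

  qpoch : Carrier → Carrier → ℕ → Carrier
  qpoch x q zero    = 1#
  qpoch x q (suc k) = qpoch x q k * (1# + - (x * pow q k))

  -- 1/(x;q)_n for n ∈ ℤ, following (x)_n = (x)_∞/(xq^n)_∞:
  --   n = k ≥ 0 :  ((x;q)_k)⁻¹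
  --   n = -k < 0:  (x)_{-k} = 1 / prod_{j=1}^{k} (1 - x q^{-j}),
  --                so 1/(x)_{-k} = prod_{j=1}^{k} (1 - x q^{-j}).
  invQpoch : Carrier → Carrier → ℤ → Carrier
  invQpoch x q (+ k)    = (qpoch x q k) ⁻¹
  invQpoch x q -[1+ k ] = prodFin (suc k) (λ j → 1# + - (x * pow (q ⁻¹) (suc (toℕ j))))

  qbin : Carrier → ℤ → ℤ → Carrier
  qbin q (+ n)    (+ m) with m ℕ.≤? n
  ... | yes _ = qpoch q q n * ((qpoch q q m * qpoch q q (n ℕ.∸ m)) ⁻¹)
  ... | no  _ = 0#
  qbin q (+ n)    -[1+ m ] = 0#
  qbin q -[1+ n ] m        = 0#

  boxSum : (k B : ℕ) → ((Fin k → ℕ) → Carrier) → Carrier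
  boxSum zero    B f = f (λ ())
  boxSum (suc k) B f = sumTo B (λ a → boxSum k B (λ m → f (λ { zero → a ; (suc i) → m i })))

-- extension of m : Fin k → ℕ (0-indexed m_1..m_k) to ℕ → ℕ by zero,
-- so that ext m j = m_{j+1} for j < k and ext m k = m_{k+1} := 0.
ext : ∀ {k} → (Fin k → ℕ) → ℕ → ℕ
ext {zero}  m j       = 0
ext {suc k} m zero    = m zero
ext {suc k} m (suc j) = ext (λ i → m (suc i)) j

module Summand {c ℓ : Level} (F : Field c ℓ) where
  open Field F using (Carrier; _≈_; _+_; _*_; -_; 0#; 1#; _⁻¹)
  open Over F

  -- the summand  prod_{i=1}^{r-1} z_i^{m_i-m_{i+1}} q^{m_i^2-m_i m_{i+1}}
  --   / (z_i q)_{m_1-m_{i+1}} * [n_i - m_1 + m_i brack m_i - m_{i+1}],  m_r := 0,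
  -- with k = r - 1 (Fin k indexes i = 1..r-1, 0-based).
  summand : (k : ℕ) → (z : Fin k → Carrier) → (q : Carrier) → (n : Fin k → ℕ)
          → (m : Fin k → ℕ) → Carrier
  summand k z q n m = prodFin k λ i →
    let mi  = + m i
        mi' = + ext m (suc (toℕ i))
        m1  = + ext m 0
    in  powℤ (z i) (mi ℤ.- mi')
      * powℤ q (mi ℤ.* mi ℤ.- mi ℤ.* mi')
      * invQpoch (z i * q) q (m1 ℤ.- mi')
      * qbin q ((+ n i) ℤ.- m1 ℤ.+ mi) (mi ℤ.- mi')

  rhs : (k : ℕ) → (z : Fin k → Carrier) → (q : Carrier) → (n : Fin k → ℕ) → Carrier
  rhs k z q n = prodFin k λ i → (qpoch (z i * q) q (n i)) ⁻¹

{-# OPTIONS --safe #-}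
-- The summand vanishes unless m₁ ≥ m₂ ≥ ⋯ ≥ m_{r-1} (otherwise some q-binomial has a
-- negative lower entry) and unless m₁ ≤ n_{r-1} (otherwise the last q-binomial has top
-- n_{r-1} - m₁ + m_{r-1} < m_{r-1}); so the box B ≥ n_{r-1} contains the whole support and,
-- with a = m_{r-1}, the substitution mᵢ = m′ᵢ + a (i < r-1) is a bijection of the support.
-- Under it the i-th factor (i < r-1) only gains q^{a(m′ᵢ - m′ᵢ₊₁)}, and these powers telescope
-- to q^{a m′₁}. The sum over a is then the case r = 2,
--   Σ_a q^{ac+a²} z^a [N a] / (zq)_{c+a} = 1/(zq)_{c+N}   (c = m′₁, N = n_{r-1} - m′₁),
-- which follows by induction on N from the q-Pascal rule. What is left is the identity
-- for r - 1 times 1/(z_{r-1}q)_{n_{r-1}}.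
module Submission where

open import Defs
open import Data.Nat using (ℕ; suc; _≤_; _∸_)
open import Data.Fin using (Fin)
open import Data.Fin as Fin using ()
open import Data.Product using (∃)
open import Relation.Nullary using (¬_)

open import Level using (Level)
open import Data.Nat as ℕ using (zero; z≤n; s≤s; _<_)
import Data.Nat.Properties as ℕP
import Data.Nat.Solver
open import Data.Integer as ℤ using (ℤ; +_; -[1+_])
import Data.Integer.Properties as ℤP
open import Data.Integer.Solver using (module +-*-Solver)
open import Data.Fin using (zero; suc; toℕ; fromℕ; inject₁)
import Data.Fin.Properties as FinP
open import Data.Vec.Functional using (_∷_; tail; init; last)
open import Data.Vec.Functional.Properties using (∷-cong)
open import Data.Product using (_,_; ∃-syntax)
open import Data.Sum using (_⊎_; inj₁; inj₂)
open import Data.Empty using (⊥-elim)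
open import Relation.Nullary using (yes; no)
open import Relation.Binary.Core using (_Preserves_⟶_)
open import Relation.Binary.Definitions using (tri<; tri≈; tri>)
open import Relation.Binary.PropositionalEquality as ≡ using (_≡_; _≗_)

module _ where
  open +-*-Solver
  open ≡ using (refl; sym; trans; cong)

  +m-+n≡+[m∸n] : ∀ {m n} → n ≤ m → + m ℤ.- + n ≡ + (m ∸ n)
  +m-+n≡+[m∸n] {m} {n} n≤m = trans (ℤP.m-n≡m⊖n m n) (ℤP.⊖-≥ n≤m)

  +m-+n≡-[1+n∸1+m] : ∀ {m n} → m < n → + m ℤ.- + n ≡ -[1+ n ∸ suc m ]
  +m-+n≡-[1+n∸1+m] {m} {suc n} (s≤s m≤n) = trans (ℤP.m-n≡m⊖n m (suc n))
    (trans (ℤP.⊖-< (s≤s m≤n)) (cong (λ d → ℤ.- + d) (ℕP.+-∸-assoc 1 m≤n)))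

  +m*+m-+m*+n≡+[m*[m∸n]] : ∀ {m n} → n ≤ m → + m ℤ.* + m ℤ.- + m ℤ.* + n ≡ + (m ℕ.* (m ∸ n))
  +m*+m-+m*+n≡+[m*[m∸n]] {m} {n} n≤m = begin
    + m ℤ.* + m ℤ.- + m ℤ.* + n  ≡⟨ solve 2 (λ m n → m :* m :- m :* n := m :* (m :- n)) refl (+ m) (+ n) ⟩
    + m ℤ.* (+ m ℤ.- + n)       ≡⟨ cong (+ m ℤ.*_) (+m-+n≡+[m∸n] n≤m) ⟩
    + m ℤ.* + (m ∸ n)           ≡⟨ ℤP.pos-* m (m ∸ n) ⟨
    + (m ℕ.* (m ∸ n))           ∎
    where open ≡.≡-Reasoning

  +[m+a]-+[n+a]≡+m-+n : ∀ m n a → + (m ℕ.+ a) ℤ.- + (n ℕ.+ a) ≡ + m ℤ.- + n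
  +[m+a]-+[n+a]≡+m-+n m n a = solve 3 (λ m n a → (m :+ a) :- (n :+ a) := m :- n) refl (+ m) (+ n) (+ a)

  +l-+[m+a]++[n+a]≡+l-+m++n : ∀ l m n a →
    + l ℤ.- + (m ℕ.+ a) ℤ.+ + (n ℕ.+ a) ≡ + l ℤ.- + m ℤ.+ + n
  +l-+[m+a]++[n+a]≡+l-+m++n l m n a =
    solve 4 (λ l m n a → l :- (m :+ a) :+ (n :+ a) := l :- m :+ n) refl (+ l) (+ m) (+ n) (+ a)

  +l-+[m+a]++a≡+[l∸m] : ∀ {l m} a → m ≤ l → + l ℤ.- + (m ℕ.+ a) ℤ.+ + a ≡ + (l ∸ m)
  +l-+[m+a]++a≡+[l∸m] {l} {m} a m≤l =
    trans (solve 3 (λ l m a → l :- (m :+ a) :+ a := l :- m) refl (+ l) (+ m) (+ a)) (+m-+n≡+[m∸n] m≤l)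

  +l-+m++n≡+w⇒w+m≡l+n : ∀ l m n w → + l ℤ.- + m ℤ.+ + n ≡ + w → w ℕ.+ m ≡ l ℕ.+ n
  +l-+m++n≡+w⇒w+m≡l+n l m n w eq = ℤP.+-injective (trans (cong (ℤ._+ + m) (sym eq))
    (solve 3 (λ l m n → l :- m :+ n :+ m := l :+ n) refl (+ l) (+ m) (+ n)))

[m+a]*[m∸n]+a*n≡m*[m∸n]+a*m : ∀ {m n} a → n ≤ m → (m ℕ.+ a) ℕ.* (m ∸ n) ℕ.+ a ℕ.* n ≡ m ℕ.* (m ∸ n) ℕ.+ a ℕ.* m
[m+a]*[m∸n]+a*n≡m*[m∸n]+a*m {m} {n} a n≤m =
  ≡.subst (λ m′ → (m′ ℕ.+ a) ℕ.* (m ∸ n) ℕ.+ a ℕ.* n ≡ m′ ℕ.* (m ∸ n) ℕ.+ a ℕ.* m′) (ℕP.m∸n+n≡m n≤m)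
    (solve 3 (λ d n a → ((d :+ n) :+ a) :* d :+ a :* n := (d :+ n) :* d :+ a :* (d :+ n)) ≡.refl (m ∸ n) n a)
  where open Data.Nat.Solver.+-*-Solver

infixl 5 _∷ʳ_
_∷ʳ_ : ∀ {a} {A : Set a} {k} → (Fin k → A) → A → Fin (suc k) → A
_∷ʳ_ {k = zero}  m x zero    = x
_∷ʳ_ {k = suc k} m x zero    = m zero
_∷ʳ_ {k = suc k} m x (suc i) = (tail m ∷ʳ x) i

∷ʳ-cong : ∀ {a} {A : Set a} {k} {m m′ : Fin k → A} x → m ≗ m′ → m ∷ʳ x ≗ m′ ∷ʳ x
∷ʳ-cong {k = zero}  x eq zero    = ≡.refl
∷ʳ-cong {k = suc k} x eq zero    = eq zero
∷ʳ-cong {k = suc k} x eq (suc i) = ∷ʳ-cong x (λ j → eq (suc j)) i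

shift : ∀ {k} → ℕ → (Fin k → ℕ) → Fin k → ℕ
shift a m i = m i ℕ.+ a

ext-cong : ∀ {k} {m m′ : Fin k → ℕ} → m ≗ m′ → ext m ≗ ext m′
ext-cong {zero}  eq j       = ≡.refl
ext-cong {suc k} eq zero    = eq zero
ext-cong {suc k} eq (suc j) = ext-cong (λ i → eq (suc i)) j

ext-toℕ : ∀ {k} (m : Fin k → ℕ) i → ext m (toℕ i) ≡ m i
ext-toℕ m zero    = ≡.refl
ext-toℕ m (suc i) = ext-toℕ (tail m) i

ext-≥ : ∀ {k} (m : Fin k → ℕ) {j} → k ≤ j → ext m j ≡ 0
ext-≥ {zero}  m k≤j             = ≡.refl
ext-≥ {suc k} m {suc j} (s≤s k≤j) = ext-≥ (tail m) k≤j

ext-∷ʳ-< : ∀ {k} (m : Fin k → ℕ) x {j} → j < k → ext (m ∷ʳ x) j ≡ ext m j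
ext-∷ʳ-< {suc k} m x {zero}  j<k       = ≡.refl
ext-∷ʳ-< {suc k} m x {suc j} (s≤s j<k) = ext-∷ʳ-< (tail m) x j<k

ext-∷ʳ-last : ∀ {k} (m : Fin k → ℕ) x → ext (m ∷ʳ x) k ≡ x
ext-∷ʳ-last {zero}  m x = ≡.refl
ext-∷ʳ-last {suc k} m x = ext-∷ʳ-last (tail m) x

ext-∷ʳ-toℕ : ∀ {k} (m : Fin k → ℕ) x i → ext (m ∷ʳ x) (toℕ i) ≡ m i
ext-∷ʳ-toℕ m x i = ≡.trans (ext-∷ʳ-< m x (FinP.toℕ<n i)) (ext-toℕ m i)

ext-shift-∷ʳ : ∀ {k} (m : Fin k → ℕ) a {j} → j ≤ k → ext (shift a m ∷ʳ a) j ≡ ext m j ℕ.+ a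
ext-shift-∷ʳ {zero}  m a z≤n             = ≡.refl
ext-shift-∷ʳ {suc k} m a {zero}  _        = ≡.refl
ext-shift-∷ʳ {suc k} m a {suc j} (s≤s j≤k) = ext-shift-∷ʳ (tail m) a j≤k

Decreasing : ∀ {k} → (Fin k → ℕ) → Set
Decreasing m = ∀ j → ext m (suc j) ≤ ext m j

decreasing⊎ascent : ∀ {k} (m : Fin k → ℕ) → Decreasing m ⊎ ∃[ i ] m i < ext m (suc (toℕ i))
decreasing⊎ascent {zero}  m = inj₁ (λ _ → z≤n)
decreasing⊎ascent {suc k} m with ℕP.≤-<-connex (ext m 1) (m zero) | decreasing⊎ascent (tail m)
... | inj₂ lt  | _            = inj₂ (zero , lt)
... | inj₁ _   | inj₂ (i , lt) = inj₂ (suc i , lt)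
... | inj₁ le  | inj₁ dec     = inj₁ λ { zero → le ; (suc j) → dec j }

Decreasing⇒antitone : ∀ {k} {m : Fin k → ℕ} → Decreasing m → ∀ {s t} → s ≤ t → ext m t ≤ ext m s
Decreasing⇒antitone {m = m} dec {t = zero} z≤n = ℕP.≤-refl
Decreasing⇒antitone {m = m} dec {s} {suc t} s≤1+t with ℕP.m≤n⇒m<n∨m≡n s≤1+t
... | inj₁ (s≤s s≤t) = ℕP.≤-trans (dec t) (Decreasing⇒antitone {m = m} dec s≤t)
... | inj₂ ≡.refl     = ℕP.≤-refl

Decreasing-∷ʳ⇒≥ : ∀ {k} {m : Fin k → ℕ} {x} → Decreasing (m ∷ʳ x) → ∀ i → x ≤ m i
Decreasing-∷ʳ⇒≥ {k} {m} {x} dec i = ≡.subst₂ _≤_ (ext-∷ʳ-last m x) (ext-∷ʳ-toℕ m x i)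
  (Decreasing⇒antitone {m = m ∷ʳ x} dec (ℕP.<⇒≤ (FinP.toℕ<n i)))

Decreasing-∷ʳ⇒≤head : ∀ {k} {m : Fin k → ℕ} {x} → Decreasing (m ∷ʳ x) → ∀ i → m i ≤ ext (m ∷ʳ x) 0
Decreasing-∷ʳ⇒≤head {k} {m} {x} dec i = ≡.subst (_≤ ext (m ∷ʳ x) 0) (ext-∷ʳ-toℕ m x i)
  (Decreasing⇒antitone {m = m ∷ʳ x} dec {t = toℕ i} z≤n)

module _ {ℓ₁ ℓ₂ : Level} (F : Field ℓ₁ ℓ₂) where
  open Field F hiding (zero)
  open Over F
  open Summand F
  open import Relation.Binary.Reasoning.Setoid setoid
  open import Algebra.Solver.Ring.NaturalCoefficients.Default commutativeSemiring
  open import Algebra.Properties.Ring ring using (-‿distribʳ-*)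

  1≉0 : ¬ (1# ≈ 0#)
  1≉0 1≈0 = 0≉1 (sym 1≈0)

  ≉0-resp : ∀ {x y} → x ≈ y → ¬ (x ≈ 0#) → ¬ (y ≈ 0#)
  ≉0-resp x≈y x≉0 y≈0 = x≉0 (trans x≈y y≈0)

  ⁻¹-inverseˡ : ∀ {x} → ¬ (x ≈ 0#) → x ⁻¹ * x ≈ 1#
  ⁻¹-inverseˡ {x} x≉0 = trans (*-comm (x ⁻¹) x) (⁻¹-inverse x x≉0)

  x*y⁻¹*y≈x : ∀ x {y} → ¬ (y ≈ 0#) → x * y ⁻¹ * y ≈ x
  x*y⁻¹*y≈x x {y} y≉0 = begin
    x * y ⁻¹ * y    ≈⟨ *-assoc x (y ⁻¹) y ⟩
    x * (y ⁻¹ * y)  ≈⟨ *-congˡ (⁻¹-inverseˡ y≉0) ⟩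
    x * 1#          ≈⟨ *-identityʳ x ⟩
    x               ∎

  *-cancelʳ-≉0 : ∀ {d x y} → ¬ (d ≈ 0#) → x * d ≈ y * d → x ≈ y
  *-cancelʳ-≉0 {d} {x} {y} d≉0 xd≈yd = begin
    x                ≈⟨ *-identityʳ x ⟨
    x * 1#           ≈⟨ *-congˡ (⁻¹-inverse d d≉0) ⟨
    x * (d * d ⁻¹)   ≈⟨ *-assoc x d (d ⁻¹) ⟨
    x * d * d ⁻¹     ≈⟨ *-congʳ xd≈yd ⟩
    y * d * d ⁻¹     ≈⟨ *-assoc y d (d ⁻¹) ⟩
    y * (d * d ⁻¹)   ≈⟨ *-congˡ (⁻¹-inverse d d≉0) ⟩
    y * 1#           ≈⟨ *-identityʳ y ⟩
    y                ∎

  *-≉0 : ∀ {x y} → ¬ (x ≈ 0#) → ¬ (y ≈ 0#) → ¬ (x * y ≈ 0#)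
  *-≉0 {x} {y} x≉0 y≉0 xy≈0 = y≉0 (begin
    y                ≈⟨ *-identityˡ y ⟨
    1# * y           ≈⟨ *-congʳ (⁻¹-inverseˡ x≉0) ⟨
    x ⁻¹ * x * y     ≈⟨ *-assoc (x ⁻¹) x y ⟩
    x ⁻¹ * (x * y)   ≈⟨ *-congˡ xy≈0 ⟩
    x ⁻¹ * 0#        ≈⟨ zeroʳ (x ⁻¹) ⟩
    0#               ∎)

  [x*y]⁻¹*y≈x⁻¹ : ∀ {x y} → ¬ (x ≈ 0#) → ¬ (y ≈ 0#) → (x * y) ⁻¹ * y ≈ x ⁻¹
  [x*y]⁻¹*y≈x⁻¹ {x} {y} x≉0 y≉0 = *-cancelʳ-≉0 x≉0 (begin
    (x * y) ⁻¹ * y * x    ≈⟨ *-assoc _ y x ⟩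
    (x * y) ⁻¹ * (y * x)  ≈⟨ *-congˡ (*-comm y x) ⟩
    (x * y) ⁻¹ * (x * y)  ≈⟨ ⁻¹-inverseˡ (*-≉0 x≉0 y≉0) ⟩
    1#                    ≈⟨ ⁻¹-inverseˡ x≉0 ⟨
    x ⁻¹ * x              ∎)

  pow-+ : ∀ x m n → pow x (m ℕ.+ n) ≈ pow x m * pow x n
  pow-+ x zero    n = sym (*-identityˡ _)
  pow-+ x (suc m) n = trans (*-congˡ (pow-+ x m n)) (sym (*-assoc x _ _))

  [1-x]+x≈1 : ∀ x → 1# + - x + x ≈ 1#
  [1-x]+x≈1 x = begin
    1# + - x + x     ≈⟨ +-assoc 1# (- x) x ⟩
    1# + (- x + x)   ≈⟨ +-congˡ (-‿inverseˡ x) ⟩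
    1# + 0#          ≈⟨ +-identityʳ 1# ⟩
    1#               ∎

  x*[1-y]+[1-x]≈1-xy : ∀ x y → x * (1# + - y) + (1# + - x) ≈ 1# + - (x * y)
  x*[1-y]+[1-x]≈1-xy x y = begin
    x * (1# + - y) + (1# + - x)  ≈⟨ solve 4 (λ x y -x -y → x :* (con 1 :+ -y) :+ (con 1 :+ -x)
                                      := (x :+ -x) :+ (con 1 :+ x :* -y)) refl x y (- x) (- y) ⟩
    (x + - x) + (1# + x * - y)   ≈⟨ +-cong (-‿inverseʳ x) (+-congˡ (sym (-‿distribʳ-* x y))) ⟩
    0# + (1# + - (x * y))        ≈⟨ +-identityˡ _ ⟩
    1# + - (x * y)               ∎

  sumTo-cong : ∀ B {f g : ℕ → Carrier} → (∀ a → f a ≈ g a) → sumTo B f ≈ sumTo B g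
  sumTo-cong zero    f≈g = f≈g 0
  sumTo-cong (suc B) f≈g = +-cong (sumTo-cong B f≈g) (f≈g (suc B))

  sumTo-zero : ∀ B {f : ℕ → Carrier} → (∀ a → f a ≈ 0#) → sumTo B f ≈ 0#
  sumTo-zero zero    f≈0 = f≈0 0
  sumTo-zero (suc B) f≈0 = trans (+-cong (sumTo-zero B f≈0) (f≈0 (suc B))) (+-identityʳ 0#)

  sumTo-+ : ∀ B (f g : ℕ → Carrier) → sumTo B (λ a → f a + g a) ≈ sumTo B f + sumTo B g
  sumTo-+ zero    f g = refl
  sumTo-+ (suc B) f g = trans (+-congʳ (sumTo-+ B f g))
    (solve 4 (λ a b c d → (a :+ b) :+ (c :+ d) := (a :+ c) :+ (b :+ d)) refl _ _ _ _)

  sumTo-*ˡ : ∀ B (f : ℕ → Carrier) x → sumTo B (λ a → x * f a) ≈ x * sumTo B f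
  sumTo-*ˡ zero    f x = refl
  sumTo-*ˡ (suc B) f x = trans (+-congʳ (sumTo-*ˡ B f x)) (sym (distribˡ x _ _))

  sumTo-*ʳ : ∀ B (f : ℕ → Carrier) x → sumTo B (λ a → f a * x) ≈ sumTo B f * x
  sumTo-*ʳ zero    f x = refl
  sumTo-*ʳ (suc B) f x = trans (+-congʳ (sumTo-*ʳ B f x)) (sym (distribʳ x _ _))

  sumTo-comm : ∀ B B′ (f : ℕ → ℕ → Carrier) →
    sumTo B (λ x → sumTo B′ (f x)) ≈ sumTo B′ (λ a → sumTo B (λ x → f x a))
  sumTo-comm zero    B′ f = refl
  sumTo-comm (suc B) B′ f = trans (+-congʳ (sumTo-comm B B′ f)) (sym (sumTo-+ B′ _ _))

  sumTo-suc : ∀ B (f : ℕ → Carrier) → sumTo (suc B) f ≈ f 0 + sumTo B (λ a → f (suc a))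
  sumTo-suc zero    f = refl
  sumTo-suc (suc B) f = trans (+-congʳ (sumTo-suc B f)) (+-assoc _ _ _)

  sumTo-head : ∀ B (f : ℕ → Carrier) → (∀ a → f (suc a) ≈ 0#) → sumTo B f ≈ f 0
  sumTo-head zero    f f≈0 = refl
  sumTo-head (suc B) f f≈0 = trans (+-cong (sumTo-head B f f≈0) (f≈0 B)) (+-identityʳ _)

  sumTo-shift-suc : ∀ B (f : ℕ → Carrier) → f 0 ≈ 0# → f (suc B) ≈ 0# →
    sumTo B f ≈ sumTo B (λ x → f (suc x))
  sumTo-shift-suc zero    f f0≈0 f1≈0 = trans f0≈0 (sym f1≈0)
  sumTo-shift-suc (suc B) f f0≈0 fB≈0 = begin
    sumTo (suc B) f                          ≈⟨ sumTo-suc B f ⟩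
    f 0 + sumTo B (λ x → f (suc x))          ≈⟨ +-congʳ f0≈0 ⟩
    0# + sumTo B (λ x → f (suc x))           ≈⟨ +-identityˡ _ ⟩
    sumTo B (λ x → f (suc x))                ≈⟨ +-identityʳ _ ⟨
    sumTo B (λ x → f (suc x)) + 0#           ≈⟨ +-congˡ fB≈0 ⟨
    sumTo (suc B) (λ x → f (suc x))          ∎

  sumTo-shift : ∀ B a (f : ℕ → Carrier) → (∀ x → x < a → f x ≈ 0#) → (∀ x → B < x → f x ≈ 0#) →
    sumTo B f ≈ sumTo B (λ x → f (x ℕ.+ a))
  sumTo-shift B zero    f low high = sumTo-cong B (λ x → reflexive (≡.cong f (≡.sym (ℕP.+-identityʳ x))))
  sumTo-shift B (suc a) f low high = begin
    sumTo B f                        ≈⟨ sumTo-shift B a f (λ x x<a → low x (ℕP.m<n⇒m<1+n x<a)) high ⟩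
    sumTo B (λ x → f (x ℕ.+ a))      ≈⟨ sumTo-shift-suc B _ (low a ℕP.≤-refl) (high _ (s≤s (ℕP.m≤m+n B a))) ⟩
    sumTo B (λ x → f (suc x ℕ.+ a))  ≈⟨ sumTo-cong B (λ x → reflexive (≡.cong f (≡.sym (ℕP.+-suc x a)))) ⟩
    sumTo B (λ x → f (x ℕ.+ suc a))  ∎

  boxSum-cong : ∀ k B {f g : (Fin k → ℕ) → Carrier} → (∀ m → f m ≈ g m) → boxSum k B f ≈ boxSum k B g
  boxSum-cong zero    B f≈g = f≈g _
  boxSum-cong (suc k) B f≈g = sumTo-cong B (λ a → boxSum-cong k B (λ m → f≈g _))

  boxSum-zero : ∀ k B {f : (Fin k → ℕ) → Carrier} → (∀ m → f m ≈ 0#) → boxSum k B f ≈ 0#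
  boxSum-zero zero    B f≈0 = f≈0 _
  boxSum-zero (suc k) B f≈0 = sumTo-zero B (λ a → boxSum-zero k B (λ m → f≈0 _))

  boxSum-*ʳ : ∀ k B (f : (Fin k → ℕ) → Carrier) x → boxSum k B (λ m → f m * x) ≈ boxSum k B f * x
  boxSum-*ʳ zero    B f x = refl
  boxSum-*ʳ (suc k) B f x = trans (sumTo-cong B (λ a → boxSum-*ʳ k B _ x)) (sumTo-*ʳ B _ x)

  boxSum-sumTo-comm : ∀ k B B′ (f : (Fin k → ℕ) → ℕ → Carrier) →
    boxSum k B (λ m → sumTo B′ (f m)) ≈ sumTo B′ (λ a → boxSum k B (λ m → f m a))
  boxSum-sumTo-comm zero    B B′ f = refl
  boxSum-sumTo-comm (suc k) B B′ f =
    trans (sumTo-cong B (λ x → boxSum-sumTo-comm k B B′ _)) (sumTo-comm B B′ _)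

  boxSum-∷ : ∀ k B {f : (Fin (suc k) → ℕ) → Carrier} → f Preserves _≗_ ⟶ _≈_ →
    boxSum (suc k) B f ≈ sumTo B (λ x → boxSum k B (λ m → f (x ∷ m)))
  boxSum-∷ k B f-cong = sumTo-cong B (λ x → boxSum-cong k B (λ m → f-cong λ { zero → ≡.refl ; (suc i) → ≡.refl }))

  boxSum-∷ʳ : ∀ k B {f : (Fin (suc k) → ℕ) → Carrier} → f Preserves _≗_ ⟶ _≈_ →
    boxSum (suc k) B f ≈ boxSum k B (λ m → sumTo B (λ a → f (m ∷ʳ a)))
  boxSum-∷ʳ zero    B f-cong = sumTo-cong B (λ a → f-cong λ { zero → ≡.refl })
  boxSum-∷ʳ (suc k) B {f} f-cong = begin
    boxSum (suc (suc k)) B f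
      ≈⟨ boxSum-∷ (suc k) B f-cong ⟩
    sumTo B (λ x → boxSum (suc k) B (λ m → f (x ∷ m)))
      ≈⟨ sumTo-cong B (λ x → boxSum-∷ʳ k B {λ m → f (x ∷ m)} (λ eq → f-cong (∷-cong ≡.refl eq))) ⟩
    sumTo B (λ x → boxSum k B (λ m → sumTo B (λ a → f (x ∷ (m ∷ʳ a)))))
      ≈⟨ sumTo-cong B (λ x → boxSum-cong k B (λ m → sumTo-cong B (λ a →
           f-cong λ { zero → ≡.refl ; (suc i) → ≡.refl }))) ⟩
    sumTo B (λ x → boxSum k B (λ m → sumTo B (λ a → f ((x ∷ m) ∷ʳ a))))
      ≈⟨ boxSum-∷ k B (λ eq → sumTo-cong B (λ a → f-cong (∷ʳ-cong a eq))) ⟨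
    boxSum (suc k) B (λ m → sumTo B (λ a → f (m ∷ʳ a)))
      ∎

  boxSum-shift : ∀ k B a {f : (Fin k → ℕ) → Carrier} → f Preserves _≗_ ⟶ _≈_ →
    (∀ m i → m i < a → f m ≈ 0#) → (∀ m i → B < m i → f m ≈ 0#) →
    boxSum k B f ≈ boxSum k B (λ m → f (shift a m))
  boxSum-shift zero    B a f-cong low high = f-cong (λ ())
  boxSum-shift (suc k) B a {f} f-cong low high = begin
    boxSum (suc k) B f
      ≈⟨ boxSum-∷ k B f-cong ⟩
    sumTo B (λ x → boxSum k B (λ m → f (x ∷ m)))
      ≈⟨ sumTo-cong B (λ x → boxSum-shift k B a {λ m → f (x ∷ m)} (λ eq → f-cong (∷-cong ≡.refl eq))
           (λ m i → low _ (suc i)) (λ m i → high _ (suc i))) ⟩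
    sumTo B (λ x → boxSum k B (λ m → f (x ∷ shift a m)))
      ≈⟨ sumTo-shift B a _ (λ x x<a → boxSum-zero k B (λ m → low _ zero x<a))
                           (λ x B<x → boxSum-zero k B (λ m → high _ zero B<x)) ⟩
    sumTo B (λ x → boxSum k B (λ m → f ((x ℕ.+ a) ∷ shift a m)))
      ≈⟨ sumTo-cong B (λ x → boxSum-cong k B (λ m → f-cong λ { zero → ≡.refl ; (suc i) → ≡.refl })) ⟩
    sumTo B (λ x → boxSum k B (λ m → f (shift a (x ∷ m))))
      ≈⟨ boxSum-∷ k B (λ eq → f-cong (λ i → ≡.cong (ℕ._+ a) (eq i))) ⟨
    boxSum (suc k) B (λ m → f (shift a m))
      ∎

  boxSum-∷ʳ-shift : ∀ k B {f : (Fin (suc k) → ℕ) → Carrier} → f Preserves _≗_ ⟶ _≈_ →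
    (∀ a m i → m i < a → f (m ∷ʳ a) ≈ 0#) → (∀ a m i → B < m i → f (m ∷ʳ a) ≈ 0#) →
    boxSum (suc k) B f ≈ sumTo B (λ a → boxSum k B (λ m → f (shift a m ∷ʳ a)))
  boxSum-∷ʳ-shift k B {f} f-cong low high = begin
    boxSum (suc k) B f
      ≈⟨ boxSum-∷ʳ k B f-cong ⟩
    boxSum k B (λ m → sumTo B (λ a → f (m ∷ʳ a)))
      ≈⟨ boxSum-sumTo-comm k B B (λ m a → f (m ∷ʳ a)) ⟩
    sumTo B (λ a → boxSum k B (λ m → f (m ∷ʳ a)))
      ≈⟨ sumTo-cong B (λ a → boxSum-shift k B a (λ eq → f-cong (∷ʳ-cong a eq)) (low a) (high a)) ⟩
    sumTo B (λ a → boxSum k B (λ m → f (shift a m ∷ʳ a)))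
      ∎

  prodFin-cong : ∀ k {f g : Fin k → Carrier} → (∀ i → f i ≈ g i) → prodFin k f ≈ prodFin k g
  prodFin-cong zero    f≈g = refl
  prodFin-cong (suc k) f≈g = *-cong (f≈g zero) (prodFin-cong k (λ i → f≈g (suc i)))

  prodFin-zero : ∀ k (f : Fin k → Carrier) i → f i ≈ 0# → prodFin k f ≈ 0#
  prodFin-zero (suc k) f zero    fi≈0 = trans (*-congʳ fi≈0) (zeroˡ _)
  prodFin-zero (suc k) f (suc i) fi≈0 = trans (*-congˡ (prodFin-zero k (tail f) i fi≈0)) (zeroʳ _)

  prodFin-∷ʳ : ∀ k (f : Fin (suc k) → Carrier) → prodFin (suc k) f ≈ prodFin k (init f) * last f
  prodFin-∷ʳ zero    f = trans (*-identityʳ _) (sym (*-identityˡ _))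
  prodFin-∷ʳ (suc k) f = trans (*-congˡ (prodFin-∷ʳ k (tail f))) (sym (*-assoc _ _ _))

  module Summands (q : Carrier) where

    qfac : ℕ → Carrier
    qfac = qpoch q q

    binom : ℕ → ℕ → Carrier
    binom N a = qbin q (+ N) (+ a)

    binom-> : ∀ {N a} → N < a → binom N a ≡ 0#
    binom-> {N} {a} N<a with a ℕ.≤? N
    ... | yes a≤N = ⊥-elim (ℕP.<⇒≱ N<a a≤N)
    ... | no  _   = ≡.refl

    binom-≤ : ∀ {N a} → a ≤ N → binom N a ≡ qfac N * (qfac a * qfac (N ∸ a)) ⁻¹
    binom-≤ {N} {a} a≤N with a ℕ.≤? N
    ... | yes _   = ≡.refl
    ... | no  a≰N = ⊥-elim (a≰N a≤N)

    factorℤ : Carrier → ℤ → ℤ → ℤ → ℤ → Carrier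
    factorℤ zᵢ d e c t = powℤ zᵢ d * powℤ q e * invQpoch (zᵢ * q) q c * qbin q t d

    -- factor zᵢ nᵢ m₁ mᵢ mᵢ₊₁ is the i-th factor of the summand, and
    -- summand k z q n m is by definition summandWith k z n (ext m 0) m.
    factor : Carrier → ℕ → ℕ → ℕ → ℕ → Carrier
    factor zᵢ nᵢ m₁ x y =
      factorℤ zᵢ (+ x ℤ.- + y) (+ x ℤ.* + x ℤ.- + x ℤ.* + y) (+ m₁ ℤ.- + y) (+ nᵢ ℤ.- + m₁ ℤ.+ + x)

    summandWith : (k : ℕ) → (Fin k → Carrier) → (Fin k → ℕ) → ℕ → (Fin k → ℕ) → Carrier
    summandWith k z n m₁ m = prodFin k (λ i → factor (z i) (n i) m₁ (m i) (ext m (suc (toℕ i))))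

    factorℤ-cong : ∀ zᵢ {d d′ e e′ c c′ t t′} → d ≡ d′ → e ≡ e′ → c ≡ c′ → t ≡ t′ →
      factorℤ zᵢ d e c t ≡ factorℤ zᵢ d′ e′ c′ t′
    factorℤ-cong zᵢ ≡.refl ≡.refl ≡.refl ≡.refl = ≡.refl

    factor-cong : ∀ zᵢ nᵢ {m₁ m₁′ x x′ y y′} → m₁ ≡ m₁′ → x ≡ x′ → y ≡ y′ →
      factor zᵢ nᵢ m₁ x y ≡ factor zᵢ nᵢ m₁′ x′ y′
    factor-cong zᵢ nᵢ ≡.refl ≡.refl ≡.refl = ≡.refl

    factor-natural : ∀ zᵢ nᵢ m₁ {x y} → y ≤ x →
      factor zᵢ nᵢ m₁ x y ≡ factorℤ zᵢ (+ (x ∸ y)) (+ (x ℕ.* (x ∸ y))) (+ m₁ ℤ.- + y) (+ nᵢ ℤ.- + m₁ ℤ.+ + x)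
    factor-natural zᵢ nᵢ m₁ {x} {y} y≤x =
      ≡.cong₂ (λ d e → factorℤ zᵢ d e (+ m₁ ℤ.- + y) (+ nᵢ ℤ.- + m₁ ℤ.+ + x)) (+m-+n≡+[m∸n] y≤x) (+m*+m-+m*+n≡+[m*[m∸n]] y≤x)

    qbin-negative : ∀ t d → qbin q t -[1+ d ] ≡ 0#
    qbin-negative (+ _)    d = ≡.refl
    qbin-negative -[1+ _ ] d = ≡.refl

    qbin-top< : ∀ t x → (∀ w → t ≡ + w → w < x) → qbin q t (+ x) ≡ 0#
    qbin-top< (+ w)    x w<x = binom-> (w<x w ≡.refl)
    qbin-top< -[1+ _ ] x _   = ≡.refl

    factor-qbin≡0 : ∀ zᵢ nᵢ m₁ x y → qbin q (+ nᵢ ℤ.- + m₁ ℤ.+ + x) (+ x ℤ.- + y) ≡ 0# → factor zᵢ nᵢ m₁ x y ≈ 0#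
    factor-qbin≡0 zᵢ nᵢ m₁ x y qbin≡0 = trans (*-congˡ (reflexive qbin≡0)) (zeroʳ _)

    factor-ascent : ∀ zᵢ nᵢ m₁ {x y} → x < y → factor zᵢ nᵢ m₁ x y ≈ 0#
    factor-ascent zᵢ nᵢ m₁ {x} {y} x<y = factor-qbin≡0 zᵢ nᵢ m₁ x y (≡.trans
      (≡.cong (qbin q (+ nᵢ ℤ.- + m₁ ℤ.+ + x)) (+m-+n≡-[1+n∸1+m] x<y)) (qbin-negative (+ nᵢ ℤ.- + m₁ ℤ.+ + x) _))

    factor-beyond : ∀ zᵢ {nᵢ m₁} x → nᵢ < m₁ → factor zᵢ nᵢ m₁ x 0 ≈ 0#
    factor-beyond zᵢ {nᵢ} {m₁} x nᵢ<m₁ = factor-qbin≡0 zᵢ nᵢ m₁ x 0 (≡.trans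
      (≡.cong (qbin q (+ nᵢ ℤ.- + m₁ ℤ.+ + x)) (ℤP.+-identityʳ (+ x))) (qbin-top< _ x w<x))
      where
      w<x : ∀ w → + nᵢ ℤ.- + m₁ ℤ.+ + x ≡ + w → w < x
      w<x w eq = ℕP.+-cancelʳ-< m₁ w x (≡.subst (_< x ℕ.+ m₁) (≡.sym (+l-+m++n≡+w⇒w+m≡l+n nᵢ m₁ x w eq))
        (≡.subst (nᵢ ℕ.+ x <_) (ℕP.+-comm m₁ x) (ℕP.+-monoˡ-< x nᵢ<m₁)))

    factorℤ*pow : ∀ zᵢ d c t e s →
      factorℤ zᵢ d (+ e) c t * pow q s ≈ powℤ zᵢ d * invQpoch (zᵢ * q) q c * qbin q t d * pow q (e ℕ.+ s)
    factorℤ*pow zᵢ d c t e s = begin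
      factorℤ zᵢ d (+ e) c t * pow q s
        ≈⟨ solve 5 (λ Z E I Q S → Z :* E :* I :* Q :* S := Z :* I :* Q :* (E :* S)) refl _ _ _ _ _ ⟩
      powℤ zᵢ d * invQpoch (zᵢ * q) q c * qbin q t d * (pow q e * pow q s)
        ≈⟨ *-congˡ (pow-+ q e s) ⟨
      powℤ zᵢ d * invQpoch (zᵢ * q) q c * qbin q t d * pow q (e ℕ.+ s)
        ∎

    factor-shift : ∀ zᵢ nᵢ m₁ x y a →
      factor zᵢ nᵢ (m₁ ℕ.+ a) (x ℕ.+ a) (y ℕ.+ a) * pow q (a ℕ.* y) ≈ factor zᵢ nᵢ m₁ x y * pow q (a ℕ.* x)
    factor-shift zᵢ nᵢ m₁ x y a with ℕP.≤-<-connex y x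
    ... | inj₂ x<y = trans (*-congʳ (factor-ascent zᵢ nᵢ _ (ℕP.+-monoˡ-< a x<y)))
                       (trans (zeroˡ _) (sym (trans (*-congʳ (factor-ascent zᵢ nᵢ m₁ x<y)) (zeroˡ _))))
    ... | inj₁ y≤x = begin
      factor zᵢ nᵢ (m₁ ℕ.+ a) (x ℕ.+ a) (y ℕ.+ a) * pow q (a ℕ.* y)
        ≡⟨ ≡.cong (_* pow q (a ℕ.* y)) shifted ⟩
      factorℤ zᵢ (+ d) (+ ((x ℕ.+ a) ℕ.* d)) c t * pow q (a ℕ.* y)
        ≈⟨ factorℤ*pow zᵢ (+ d) c t ((x ℕ.+ a) ℕ.* d) (a ℕ.* y) ⟩
      R * pow q ((x ℕ.+ a) ℕ.* d ℕ.+ a ℕ.* y)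
        ≡⟨ ≡.cong (λ e → R * pow q e) exponent ⟩
      R * pow q (x ℕ.* d ℕ.+ a ℕ.* x)
        ≈⟨ factorℤ*pow zᵢ (+ d) c t (x ℕ.* d) (a ℕ.* x) ⟨
      factorℤ zᵢ (+ d) (+ (x ℕ.* d)) c t * pow q (a ℕ.* x)
        ≡⟨ ≡.cong (_* pow q (a ℕ.* x)) (factor-natural zᵢ nᵢ m₁ y≤x) ⟨
      factor zᵢ nᵢ m₁ x y * pow q (a ℕ.* x)
        ∎
      where
      d = x ∸ y
      c = + m₁ ℤ.- + y
      t = + nᵢ ℤ.- + m₁ ℤ.+ + x
      R = powℤ zᵢ (+ d) * invQpoch (zᵢ * q) q c * qbin q t (+ d)

      x+a∸y+a≡d : x ℕ.+ a ∸ (y ℕ.+ a) ≡ d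
      x+a∸y+a≡d = ≡.trans (≡.cong₂ _∸_ (ℕP.+-comm x a) (ℕP.+-comm y a)) (ℕP.[m+n]∸[m+o]≡n∸o a x y)

      shifted : factor zᵢ nᵢ (m₁ ℕ.+ a) (x ℕ.+ a) (y ℕ.+ a) ≡ factorℤ zᵢ (+ d) (+ ((x ℕ.+ a) ℕ.* d)) c t
      shifted = ≡.trans (factor-natural zᵢ nᵢ (m₁ ℕ.+ a) (ℕP.+-monoˡ-≤ a y≤x))
        (factorℤ-cong zᵢ (≡.cong +_ x+a∸y+a≡d) (≡.cong (λ d′ → + ((x ℕ.+ a) ℕ.* d′)) x+a∸y+a≡d)
                         (+[m+a]-+[n+a]≡+m-+n m₁ y a) (+l-+[m+a]++[n+a]≡+l-+m++n nᵢ m₁ x a))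

      exponent : (x ℕ.+ a) ℕ.* d ℕ.+ a ℕ.* y ≡ x ℕ.* d ℕ.+ a ℕ.* x
      exponent = [m+a]*[m∸n]+a*n≡m*[m∸n]+a*m a y≤x

    summand-cong : ∀ k z n → summand k z q n Preserves _≗_ ⟶ _≈_
    summand-cong k z n eq = prodFin-cong k (λ i →
      reflexive (factor-cong (z i) (n i) (ext-cong eq 0) (eq i) (ext-cong eq (suc (toℕ i)))))

    summandWith-ascent : ∀ k z n m₁ (m : Fin k → ℕ) i → m i < ext m (suc (toℕ i)) → summandWith k z n m₁ m ≈ 0#
    summandWith-ascent k z n m₁ m i mᵢ<mᵢ₊₁ = prodFin-zero k _ i (factor-ascent (z i) (n i) m₁ mᵢ<mᵢ₊₁)

    summandWith-beyond : ∀ k z n {m₁} (m : Fin (suc k) → ℕ) → last n < m₁ → summandWith (suc k) z n m₁ m ≈ 0#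
    summandWith-beyond k z n {m₁} m nₖ<m₁ =
      prodFin-zero (suc k) (λ i → factor (z i) (n i) m₁ (m i) (ext m (suc (toℕ i)))) (fromℕ k)
      (trans (reflexive (factor-cong (last z) (last n) {m₁} {x = last m} ≡.refl ≡.refl m-after-last≡0))
             (factor-beyond (last z) (last m) nₖ<m₁))
      where
      m-after-last≡0 : ext m (suc (toℕ (fromℕ k))) ≡ 0
      m-after-last≡0 = ext-≥ m (ℕP.≤-reflexive (≡.cong suc (≡.sym (FinP.toℕ-fromℕ k))))

    summandWith-shift-∷ʳ : ∀ k (z : Fin (suc k) → Carrier) n m₁ (m : Fin k → ℕ) a →
      summandWith (suc k) z n (m₁ ℕ.+ a) (shift a m ∷ʳ a)
        ≈ summandWith k (init z) (init n) m₁ m * (pow q (a ℕ.* ext m 0) * factor (last z) (last n) (m₁ ℕ.+ a) a 0)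
    summandWith-shift-∷ʳ zero z n m₁ m a = begin
      G * 1#                        ≈⟨ *-identityʳ G ⟩
      G                             ≈⟨ *-identityˡ G ⟨
      1# * G                        ≈⟨ *-congʳ (reflexive (≡.cong (pow q) (ℕP.*-zeroʳ a))) ⟨
      pow q (a ℕ.* 0) * G           ≈⟨ *-identityˡ _ ⟨
      1# * (pow q (a ℕ.* 0) * G)    ∎
      where G = factor (z zero) (n zero) (m₁ ℕ.+ a) a 0
    summandWith-shift-∷ʳ (suc k) z n m₁ m a = begin
      factor (z zero) (n zero) (m₁ ℕ.+ a) (m zero ℕ.+ a) (ext (shift a m ∷ʳ a) 1) * P⁺
        ≈⟨ *-cong (reflexive (factor-cong (z zero) (n zero) ≡.refl ≡.refl (ext-shift-∷ʳ m a (s≤s z≤n))))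
                  (summandWith-shift-∷ʳ k (tail z) (tail n) m₁ (tail m) a) ⟩
      G⁺ * (P * (pow q (a ℕ.* y) * L))
        ≈⟨ solve 4 (λ G⁺ P Q L → G⁺ :* (P :* (Q :* L)) := (G⁺ :* Q) :* (P :* L)) refl G⁺ P (pow q (a ℕ.* y)) L ⟩
      G⁺ * pow q (a ℕ.* y) * (P * L)
        ≈⟨ *-congʳ (factor-shift (z zero) (n zero) m₁ (m zero) y a) ⟩
      G * pow q (a ℕ.* m zero) * (P * L)
        ≈⟨ solve 4 (λ G Q P L → (G :* Q) :* (P :* L) := (G :* P) :* (Q :* L)) refl G (pow q (a ℕ.* m zero)) P L ⟩
      G * P * (pow q (a ℕ.* m zero) * L)
        ∎
      where
      y = ext m 1
      P⁺ = summandWith (suc k) (tail z) (tail n) (m₁ ℕ.+ a) (shift a (tail m) ∷ʳ a)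
      G⁺ = factor (z zero) (n zero) (m₁ ℕ.+ a) (m zero ℕ.+ a) (y ℕ.+ a)
      G = factor (z zero) (n zero) m₁ (m zero) y
      P = summandWith k (init (tail z)) (init (tail n)) m₁ (tail m)
      L = factor (last z) (last n) (m₁ ℕ.+ a) a 0

    summand-ascent⊎decreasing : ∀ k z n (m : Fin k → ℕ) → summand k z q n m ≈ 0# ⊎ Decreasing m
    summand-ascent⊎decreasing k z n m with decreasing⊎ascent m
    ... | inj₁ dec           = inj₂ dec
    ... | inj₂ (i , mᵢ<mᵢ₊₁) = inj₁ (summandWith-ascent k z n (ext m 0) m i mᵢ<mᵢ₊₁)

    summand-∷ʳ-below : ∀ k z n (m : Fin k → ℕ) a i → m i < a → summand (suc k) z q n (m ∷ʳ a) ≈ 0#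
    summand-∷ʳ-below k z n m a i mᵢ<a with summand-ascent⊎decreasing (suc k) z n (m ∷ʳ a)
    ... | inj₁ ≈0  = ≈0
    ... | inj₂ dec = ⊥-elim (ℕP.<⇒≱ mᵢ<a (Decreasing-∷ʳ⇒≥ dec i))

    summand-∷ʳ-above : ∀ k z n {B} (m : Fin k → ℕ) a i → last n ≤ B → B < m i → summand (suc k) z q n (m ∷ʳ a) ≈ 0#
    summand-∷ʳ-above k z n m a i nₖ≤B B<mᵢ with summand-ascent⊎decreasing (suc k) z n (m ∷ʳ a)
    ... | inj₁ ≈0  = ≈0
    ... | inj₂ dec = summandWith-beyond k z n (m ∷ʳ a)
                       (ℕP.≤-<-trans nₖ≤B (ℕP.<-≤-trans B<mᵢ (Decreasing-∷ʳ⇒≤head dec i)))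

    summand-beyond : ∀ k z n {L} (m : Fin k → ℕ) → (∀ i → n i ≤ L) → L < ext m 0 → summand k z q n m ≈ 0#
    summand-beyond zero    z n m n≤L ()
    summand-beyond (suc k) z n m n≤L L<m₁ = summandWith-beyond k z n m (ℕP.≤-<-trans (n≤L (fromℕ k)) L<m₁)

    summand-shift-∷ʳ : ∀ k (z : Fin (suc k) → Carrier) n (m : Fin k → ℕ) a →
      summand (suc k) z q n (shift a m ∷ʳ a)
        ≈ summand k (init z) q (init n) m * (pow q (a ℕ.* ext m 0) * factor (last z) (last n) (ext m 0 ℕ.+ a) a 0)
    summand-shift-∷ʳ k z n m a =
      trans (reflexive (≡.cong (λ m₁ → summandWith (suc k) z n m₁ (shift a m ∷ʳ a)) (ext-shift-∷ʳ m a z≤n)))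
            (summandWith-shift-∷ʳ k z n (ext m 0) m a)

  module Identity (q : Carrier) (q^suc≉1 : ∀ t → ¬ ((1# + - pow q (suc t)) ≈ 0#)) where
    open Summands q

    qfac-≉0 : ∀ n → ¬ (qfac n ≈ 0#)
    qfac-≉0 zero    = 1≉0
    qfac-≉0 (suc n) = *-≉0 (qfac-≉0 n) (q^suc≉1 n)

    binom*qfac*qfac : ∀ {N a b} → a ≤ N → N ∸ a ≡ b → binom N a * (qfac a * qfac b) ≈ qfac N
    binom*qfac*qfac {N} {a} a≤N ≡.refl =
      trans (*-congʳ (reflexive (binom-≤ a≤N))) (x*y⁻¹*y≈x (qfac N) (*-≉0 (qfac-≉0 a) (qfac-≉0 (N ∸ a))))

    binom-0 : ∀ N → binom N 0 ≈ 1#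
    binom-0 N = *-cancelʳ-≉0 (qfac-≉0 N) (begin
      binom N 0 * qfac N          ≈⟨ *-congˡ (*-identityˡ (qfac N)) ⟨
      binom N 0 * (1# * qfac N)   ≈⟨ binom*qfac*qfac {N} z≤n ≡.refl ⟩
      qfac N                      ≈⟨ *-identityˡ _ ⟨
      1# * qfac N                 ∎)

    binom-diag : ∀ N → binom N N ≈ 1#
    binom-diag N = *-cancelʳ-≉0 (qfac-≉0 N) (begin
      binom N N * qfac N          ≈⟨ *-congˡ (*-identityʳ (qfac N)) ⟨
      binom N N * (qfac N * 1#)   ≈⟨ binom*qfac*qfac {N} ℕP.≤-refl (ℕP.n∸n≡0 N) ⟩
      qfac N                      ≈⟨ *-identityˡ _ ⟨
      1# * qfac N                 ∎)

    -- Multiplying by (q)_{b+1} (q)_{s+1}, where s = N - 1 - b, turns the rule into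
    -- x(1 - y) + (1 - x) = 1 - xy for x = q^{b+1} and y = q^{s+1}.
    binom-pascal-< : ∀ {N b} → b < N → binom (suc N) (suc b) ≈ pow q (suc b) * binom N (suc b) + binom N b
    binom-pascal-< {suc N′} {b} (s≤s b≤N′) = *-cancelʳ-≉0 D≉0 (begin
      binom (suc N) (suc b) * D              ≈⟨ binom*qfac*qfac (s≤s (ℕP.m≤n⇒m≤1+n b≤N′)) N∸b≡1+s ⟩
      qfac N * (1# + - pow q (suc N))        ≈⟨ *-congˡ (+-congˡ (-‿cong x*y≈q^[1+N])) ⟨
      qfac N * (1# + - (x * y))              ≈⟨ *-congˡ (x*[1-y]+[1-x]≈1-xy x y) ⟨
      qfac N * (x * β + α)                   ≈⟨ solve 4 (λ QN x β α → QN :* (x :* β :+ α) := x :* QN :* β :+ QN :* α)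
                                                   refl (qfac N) x β α ⟩
      x * qfac N * β + qfac N * α            ≈⟨ +-cong (*-congʳ (*-congˡ (binom*qfac*qfac (s≤s b≤N′) ≡.refl)))
                                                       (*-congʳ (binom*qfac*qfac (ℕP.m≤n⇒m≤1+n b≤N′) N∸b≡1+s)) ⟨
      x * (binom N (suc b) * (qfac (suc b) * qfac s)) * β + binom N b * (qfac b * qfac (suc s)) * α
        ≈⟨ solve 7 (λ x Y Z Qb α Qs β → x :* (Y :* ((Qb :* α) :* Qs)) :* β :+ Z :* (Qb :* (Qs :* β)) :* α
                                        := (x :* Y :+ Z) :* ((Qb :* α) :* (Qs :* β)))
                 refl x (binom N (suc b)) (binom N b) (qfac b) α (qfac s) β ⟩
      (x * binom N (suc b) + binom N b) * D  ∎)
      where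
      N = suc N′
      s = N′ ∸ b
      x = pow q (suc b)
      y = pow q (suc s)
      α = 1# + - pow q (suc b)
      β = 1# + - pow q (suc s)
      D = qfac (suc b) * qfac (suc s)
      D≉0 = *-≉0 (qfac-≉0 (suc b)) (qfac-≉0 (suc s))
      N∸b≡1+s : N ∸ b ≡ suc s
      N∸b≡1+s = ℕP.+-∸-assoc 1 b≤N′
      x*y≈q^[1+N] : x * y ≈ pow q (suc N)
      x*y≈q^[1+N] = trans (sym (pow-+ q (suc b) (suc s)))
        (reflexive (≡.cong (λ e → pow q (suc e)) (≡.trans (ℕP.+-suc b s) (≡.cong suc (ℕP.m+[n∸m]≡n b≤N′)))))

    binom-pascal : ∀ N b → binom (suc N) (suc b) ≈ pow q (suc b) * binom N (suc b) + binom N b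
    binom-pascal N b with ℕP.<-cmp b N
    ... | tri< b<N _ _ = binom-pascal-< b<N
    ... | tri≈ _ ≡.refl _ = begin
      binom (suc N) (suc N)                          ≈⟨ binom-diag (suc N) ⟩
      1#                                             ≈⟨ +-identityˡ 1# ⟨
      0# + 1#                                        ≈⟨ +-cong (trans (*-congˡ (reflexive (binom-> (ℕP.n<1+n N)))) (zeroʳ _))
                                                               (binom-diag N) ⟨
      pow q (suc N) * binom N (suc N) + binom N N    ∎
    ... | tri> _ _ N<b = begin
      binom (suc N) (suc b)                          ≈⟨ reflexive (binom-> (s≤s N<b)) ⟩
      0#                                             ≈⟨ +-identityʳ 0# ⟨
      0# + 0#                                        ≈⟨ +-cong (trans (*-congˡ (reflexive (binom-> (ℕP.m<n⇒m<1+n N<b)))) (zeroʳ _))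
                                                               (reflexive (binom-> N<b)) ⟨
      pow q (suc b) * binom N (suc b) + binom N b    ∎

    module OneVariable (z : Carrier) (zq^suc≉1 : ∀ t → ¬ ((1# + - (z * pow q (suc t))) ≈ 0#)) where

      izq : ℕ → Carrier
      izq c = qpoch (z * q) q c ⁻¹

      1-zq*q^t≉0 : ∀ t → ¬ ((1# + - (z * q * pow q t)) ≈ 0#)
      1-zq*q^t≉0 t = ≉0-resp (+-congˡ (-‿cong (sym (*-assoc z q (pow q t))))) (zq^suc≉1 t)

      zq-qpoch-≉0 : ∀ c → ¬ (qpoch (z * q) q c ≈ 0#)
      zq-qpoch-≉0 zero    = 1≉0
      zq-qpoch-≉0 (suc c) = *-≉0 (zq-qpoch-≉0 c) (1-zq*q^t≉0 c)

      izq-suc : ∀ c → izq c ≈ izq (suc c) * (1# + - (z * q * pow q c))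
      izq-suc c = sym ([x*y]⁻¹*y≈x⁻¹ (zq-qpoch-≉0 c) (1-zq*q^t≉0 c))

      weight : ℕ → ℕ → Carrier
      weight c a = pow q (a ℕ.* c) * (pow z a * pow q (a ℕ.* a) * izq (c ℕ.+ a))

      weight-step : ∀ c a → pow q a * weight c a + weight c (suc a) ≈ weight (suc c) a
      weight-step c a = begin
        pow q a * weight c a + weight c (suc a)
          ≈⟨ +-cong (*-congˡ (*-congˡ (*-congˡ (trans (izq-suc (c ℕ.+ a)) (*-congˡ (+-congˡ (-‿cong (*-congˡ (pow-+ q c a)))))))))
                    (*-cong (pow-+ q c (a ℕ.* c)) (*-cong (*-congˡ (*-congˡ q^[1+a]²)) (reflexive (≡.cong izq (ℕP.+-suc c a))))) ⟩
        Qa * (Qac * (Za * Qaa * (J * (1# + - (z * q * (Qc * Qa))))))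
          + Qc * Qac * (z * Za * (q * (Qa * (Qa * Qaa))) * J)
          ≈⟨ solve 9 (λ Qa Qac Za Qaa J -w Qc z q →
               Qa :* (Qac :* (Za :* Qaa :* (J :* (con 1 :+ -w)))) :+ Qc :* Qac :* (z :* Za :* (q :* (Qa :* (Qa :* Qaa))) :* J)
               := Qa :* Qac :* (Za :* Qaa :* J) :* ((con 1 :+ -w) :+ z :* q :* (Qc :* Qa)))
               refl Qa Qac Za Qaa J (- (z * q * (Qc * Qa))) Qc z q ⟩
        Qa * Qac * (Za * Qaa * J) * (1# + - (z * q * (Qc * Qa)) + z * q * (Qc * Qa))
          ≈⟨ *-congˡ ([1-x]+x≈1 _) ⟩
        Qa * Qac * (Za * Qaa * J) * 1#
          ≈⟨ *-identityʳ _ ⟩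
        Qa * Qac * (Za * Qaa * J)
          ≈⟨ *-congʳ (trans (reflexive (≡.cong (pow q) (ℕP.*-suc a c))) (pow-+ q a (a ℕ.* c))) ⟨
        weight (suc c) a
          ∎
        where
        Qa = pow q a
        Qc = pow q c
        Qac = pow q (a ℕ.* c)
        Qaa = pow q (a ℕ.* a)
        Za = pow z a
        J = izq (suc (c ℕ.+ a))
        q^[1+a]² : pow q (a ℕ.+ a ℕ.* suc a) ≈ Qa * (Qa * Qaa)
        q^[1+a]² = trans (reflexive (≡.cong (λ e → pow q (a ℕ.+ e)) (ℕP.*-suc a a)))
                     (trans (pow-+ q a _) (*-congˡ (pow-+ q a (a ℕ.* a))))

      Σweight*binom : ∀ N c {B} → N ≤ B → sumTo B (λ a → weight c a * binom N a) ≈ izq (c ℕ.+ N)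
      Σweight*binom zero c {B} _ = begin
        sumTo B (λ a → weight c a * binom 0 a)
          ≈⟨ sumTo-head B _ (λ a → trans (*-congˡ (reflexive (binom-> {a = suc a} (s≤s z≤n)))) (zeroʳ _)) ⟩
        weight c 0 * binom 0 0
          ≈⟨ *-cong (solve 1 (λ A → con 1 :* (con 1 :* con 1 :* A) := A) refl (izq (c ℕ.+ 0))) (binom-0 0) ⟩
        izq (c ℕ.+ 0) * 1#
          ≈⟨ *-identityʳ _ ⟩
        izq (c ℕ.+ 0)
          ∎
      Σweight*binom (suc N) c {suc B} (s≤s N≤B) = begin
        sumTo (suc B) (λ a → weight c a * binom (suc N) a)
          ≈⟨ sumTo-cong (suc B) pascal ⟩
        sumTo (suc B) (λ a → pow q a * (weight c a * binom N a) + v a)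
          ≈⟨ sumTo-+ (suc B) _ v ⟩
        sumTo (suc B) (λ a → pow q a * (weight c a * binom N a)) + sumTo (suc B) v
          ≈⟨ +-congˡ (sumTo-shift-suc (suc B) v refl (trans (*-congˡ (reflexive (binom-> (s≤s N≤B)))) (zeroʳ _))) ⟩
        sumTo (suc B) (λ a → pow q a * (weight c a * binom N a)) + sumTo (suc B) (λ a → v (suc a))
          ≈⟨ sumTo-+ (suc B) _ _ ⟨
        sumTo (suc B) (λ a → pow q a * (weight c a * binom N a) + weight c (suc a) * binom N a)
          ≈⟨ sumTo-cong (suc B) (λ a → trans (distrib-binom a) (*-congʳ (weight-step c a))) ⟩
        sumTo (suc B) (λ a → weight (suc c) a * binom N a)
          ≈⟨ Σweight*binom N (suc c) (ℕP.m≤n⇒m≤1+n N≤B) ⟩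
        izq (suc c ℕ.+ N)
          ≈⟨ reflexive (≡.cong izq (≡.sym (ℕP.+-suc c N))) ⟩
        izq (c ℕ.+ suc N)
          ∎
        where
        v : ℕ → Carrier
        v zero    = 0#
        v (suc a) = weight c (suc a) * binom N a

        pascal : ∀ a → weight c a * binom (suc N) a ≈ pow q a * (weight c a * binom N a) + v a
        pascal zero = begin
          weight c 0 * binom (suc N) 0               ≈⟨ *-congˡ (trans (binom-0 (suc N)) (sym (binom-0 N))) ⟩
          weight c 0 * binom N 0                     ≈⟨ *-identityˡ _ ⟨
          1# * (weight c 0 * binom N 0)              ≈⟨ +-identityʳ _ ⟨
          1# * (weight c 0 * binom N 0) + 0#         ∎
        pascal (suc a) = begin
          weight c (suc a) * binom (suc N) (suc a)
            ≈⟨ *-congˡ (binom-pascal N a) ⟩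
          weight c (suc a) * (pow q (suc a) * binom N (suc a) + binom N a)
            ≈⟨ solve 4 (λ w x b b′ → w :* (x :* b :+ b′) := x :* (w :* b) :+ w :* b′) refl _ _ _ _ ⟩
          pow q (suc a) * (weight c (suc a) * binom N (suc a)) + v (suc a)
            ∎

        distrib-binom : ∀ a → pow q a * (weight c a * binom N a) + weight c (suc a) * binom N a
                              ≈ (pow q a * weight c a + weight c (suc a)) * binom N a
        distrib-binom a = solve 4 (λ x w w′ b → x :* (w :* b) :+ w′ :* b := (x :* w :+ w′) :* b) refl _ _ _ _

      Σlast-factor : ∀ nₖ {m₁ B} → m₁ ≤ nₖ → nₖ ≤ B →
        sumTo B (λ a → pow q (a ℕ.* m₁) * factor z nₖ (m₁ ℕ.+ a) a 0) ≈ izq nₖ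
      Σlast-factor nₖ {m₁} {B} m₁≤nₖ nₖ≤B = begin
        sumTo B (λ a → pow q (a ℕ.* m₁) * factor z nₖ (m₁ ℕ.+ a) a 0)
          ≈⟨ sumTo-cong B (λ a → trans (*-congˡ (reflexive (last-factor a))) (sym (*-assoc _ _ _))) ⟩
        sumTo B (λ a → weight m₁ a * binom (nₖ ∸ m₁) a)
          ≈⟨ Σweight*binom (nₖ ∸ m₁) m₁ (ℕP.≤-trans (ℕP.m∸n≤m nₖ m₁) nₖ≤B) ⟩
        izq (m₁ ℕ.+ (nₖ ∸ m₁))
          ≡⟨ ≡.cong izq (ℕP.m+[n∸m]≡n m₁≤nₖ) ⟩
        izq nₖ
          ∎
        where
        last-factor : ∀ a → factor z nₖ (m₁ ℕ.+ a) a 0 ≡ pow z a * pow q (a ℕ.* a) * izq (m₁ ℕ.+ a) * binom (nₖ ∸ m₁) a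
        last-factor a = ≡.trans (factor-natural z nₖ (m₁ ℕ.+ a) z≤n)
          (≡.cong₂ (λ c t → factorℤ z (+ a) (+ (a ℕ.* a)) c t) (ℤP.+-identityʳ (+ (m₁ ℕ.+ a))) (+l-+[m+a]++a≡+[l∸m] a m₁≤nₖ))

    boxSum-summand≈rhs : ∀ k (z : Fin k → Carrier) (n : Fin k → ℕ) → n Preserves Fin._≤_ ⟶ _≤_ →
      (∀ i t → ¬ ((1# + - (z i * pow q (suc t))) ≈ 0#)) →
      ∀ B → (∀ i → n i ≤ B) → boxSum k B (summand k z q n) ≈ rhs k z q n
    boxSum-summand≈rhs zero    z n n-mono zq^suc≉1 B n≤B = refl
    boxSum-summand≈rhs (suc k) z n n-mono zq^suc≉1 B n≤B = begin
      boxSum (suc k) B (summand (suc k) z q n)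
        ≈⟨ boxSum-∷ʳ-shift k B (summand-cong (suc k) z n) (λ a m i → summand-∷ʳ-below k z n m a i)
             (λ a m i → summand-∷ʳ-above k z n m a i (n≤B (fromℕ k))) ⟩
      sumTo B (λ a → boxSum k B (λ m → summand (suc k) z q n (shift a m ∷ʳ a)))
        ≈⟨ sumTo-cong B (λ a → boxSum-cong k B (λ m → summand-shift-∷ʳ k z n m a)) ⟩
      sumTo B (λ a → boxSum k B (λ m → summand k (init z) q (init n) m * T m a))
        ≈⟨ boxSum-sumTo-comm k B B (λ m a → summand k (init z) q (init n) m * T m a) ⟨
      boxSum k B (λ m → sumTo B (λ a → summand k (init z) q (init n) m * T m a))
        ≈⟨ boxSum-cong k B (λ m → trans (sumTo-*ˡ B (T m) _) (Σlast m)) ⟩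
      boxSum k B (λ m → summand k (init z) q (init n) m * izₖ)
        ≈⟨ boxSum-*ʳ k B (summand k (init z) q (init n)) izₖ ⟩
      boxSum k B (summand k (init z) q (init n)) * izₖ
        ≈⟨ *-congʳ (boxSum-summand≈rhs k (init z) (init n) (λ i≤j → n-mono (inject₁-mono i≤j))
                     (λ i → zq^suc≉1 (inject₁ i)) B (λ i → n≤B (inject₁ i))) ⟩
      rhs k (init z) q (init n) * izₖ
        ≈⟨ prodFin-∷ʳ k (λ i → qpoch (z i * q) q (n i) ⁻¹) ⟨
      rhs (suc k) z q n
        ∎
      where
      open OneVariable (last z) (zq^suc≉1 (fromℕ k))
      izₖ = izq (last n)

      T : (Fin k → ℕ) → ℕ → Carrier
      T m a = pow q (a ℕ.* ext m 0) * factor (last z) (last n) (ext m 0 ℕ.+ a) a 0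

      inject₁-mono : ∀ {i j : Fin k} → i Fin.≤ j → inject₁ i Fin.≤ inject₁ j
      inject₁-mono {i} {j} = ≡.subst₂ _≤_ (≡.sym (FinP.toℕ-inject₁ i)) (≡.sym (FinP.toℕ-inject₁ j))

      Σlast : ∀ m → summand k (init z) q (init n) m * sumTo B (T m) ≈ summand k (init z) q (init n) m * izₖ
      Σlast m with ℕP.≤-<-connex (ext m 0) (last n)
      ... | inj₁ m₁≤nₖ = *-congˡ (Σlast-factor (last n) m₁≤nₖ (n≤B (fromℕ k)))
      ... | inj₂ nₖ<m₁ = trans (*-congʳ vanishes) (trans (zeroˡ _) (sym (trans (*-congʳ vanishes) (zeroˡ _))))
        where vanishes = summand-beyond k (init z) (init n) m (λ i → n-mono (FinP.≤fromℕ (inject₁ i))) nₖ<m₁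

proposition8p1 : ∀ {c ℓ} (F : Field c ℓ) → let open Field F in let open Over F in let open Summand F in
    (r : ℕ) → 2 ≤ r →
    (n : Fin (r ∸ 1) → ℕ) → (∀ i j → i Fin.≤ j → n i ≤ n j) →
    (z : Fin (r ∸ 1) → Carrier) → (q : Carrier) →
    ¬ (q ≈ 0#) → (∀ i → ¬ (z i ≈ 0#)) →
    (∀ t → ¬ ((1# + - pow q (suc t)) ≈ 0#)) →
    (∀ i t → ¬ ((1# + - (z i * pow q (suc t))) ≈ 0#)) →
    ∃ λ B → ∀ B′ → B ≤ B′ →
      boxSum (r ∸ 1) B′ (summand (r ∸ 1) z q n) ≈ rhs (r ∸ 1) z q n
proposition8p1 F zero          ()
proposition8p1 F (suc zero)    (s≤s ())
proposition8p1 F (suc (suc r)) _ n n-mono z q _ _ q^suc≉1 zq^suc≉1 =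
  n (fromℕ r) , λ B nᵣ≤B →
    Identity.boxSum-summand≈rhs F q q^suc≉1 (suc r) z n (λ {i} {j} → n-mono i j) zq^suc≉1 B
      (λ i → ℕP.≤-trans (n-mono i (fromℕ r) (FinP.≤fromℕ i)) nᵣ≤B)
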